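{- Let $u$ be a state of $\mathcal U$, $\nu$ an abstract transition and $c\in H$ with $c\neq\ell(\nu)\neq\bar c$. If $u\models\mathit{en}(\nu)$, then $u\backslash c\models\mathit{en}(\nu\backslash c)$ (where $u\backslash c$ is a state of $\mathcal U$).
   Context: ABC: sets $\mathcal A$ (agent identifiers), $\mathcal B$ (broadcast names), $\mathcal C$ (handshake names); $H=\mathcal C\cup\{\bar c\mid c\in\mathcal C\}$, $\bar{\bar c}=c$; $Act=\mathcal B!\cup\mathcal B?\cup H\cup\{\tau\}$ with $\mathcal B!=\{b!\}$, $\mathcal B?=\{b?\}$. A relabelling $f$ maps $\mathcal B\to\mathcal B$, $\mathcal C\to\mathcal C$, extended by $f(\bar c)=\overline{f(c)}$, $f(b\sharp)=f(b)\sharp$, $f(\tau)=\tau$. Expressions: $0$, $\alpha.E$, $E+F$, $E|F$, $E\backslash c$ ($c\in H$), $E[f]$, $A\in\mathcal A$ with guarded defining equations $A\stackrel{def}{=}P$. Transitions are given by the rules (with $\eta\in H\cup\{\tau\}$): (Act) $\alpha.E\xrightarrow{\alpha}E$; (Sum-l/r) a transition of $E$ (resp. $F$) is a transition of $E+F$; (Par-l/r) $E\xrightarrow{\eta}E'$ gives $E|F\xrightarrow{\eta}E'|F$, and symmetrically; (Comm) $E\xrightarrow{c}E'$, $F\xrightarrow{\bar c}F'$ give $E|F\xrightarrow{\tau}E'|F'$; (Bro-l) $E\xrightarrow{b\sharp_1}E'$ ($\sharp_1\in\{!,?\}$) and $F$ has no $b?$-transition give $E|F\xrightarrow{b\sharp_1}E'|F$;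 (Bro-r) symmetric; (Bro-c) $E\xrightarrow{b\sharp_1}E'$, $F\xrightarrow{b\sharp_2}F'$ give $E|F\xrightarrow{b(\sharp_1\circ\sharp_2)}E'|F'$ with $!\circ?=?\circ!=!$, $?\circ?=?$, $!\circ!$ undefined; (Rel) $E\xrightarrow{\ell}E'$ gives $E[f]\xrightarrow{f(\ell)}E'[f]$; (Res) $E\xrightarrow{\ell}E'$, $\ell\notin\{c,\bar c\}$ give $E\backslash c\xrightarrow{\ell}E'\backslash c$; (Rec) $P\xrightarrow{\ell}E'$, $A\stackrel{def}{=}P$ give $A\xrightarrow{\ell}E'$. Derivations of transitions are named: $(\alpha\to P)$ for (Act); $\chi|\zeta$ for (Comm)/(Bro-c); $\chi|Q$ for (Par-l)/(Bro-l); $P|\zeta$ for (Par-r)/(Bro-r); $\chi{+}Q$, $P{+}\chi$, $\chi[f]$, $\chi\backslash c$, $A{:}\chi$ for (Sum-l), (Sum-r), (Rel), (Res), (Rec); $src,target,\ell$ give source, target, label. The states of $\mathcal U$ are the expressions and the derivations; for a state $u$, $u\backslash c$ is the expression $u\backslash c$ or the derivation $u\backslash c$ (by (Res)). Concurrency $\smile^\bullet$ is the smallest relation on derivations such that (whenever the composed derivations exist): $\chi|Q\smile^\bullet P|\zeta$ and $P|\zeta\smile^\bullet\chi|Q$ if $src(\chi)=P$, $src(\zeta)=Q$; $\chi|\varsigma\smile^\bullet P|\zeta$ and $\varsigma|\chi\smile^\bullet\zeta|P$ if $src(\chi)=P$, $src(\varsigma)=src(\zeta)$, $\ell(\varsigma)\in\mathcal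 B?$; $\chi\smile^\bullet\zeta$ implies $\chi{+}P\smile^\bullet\zeta{+}P$, $P{+}\chi\smile^\bullet P{+}\zeta$, $\chi|P\smile^\bullet\zeta|P$, $P|\chi\smile^\bullet P|\zeta$; $\chi\smile^\bullet\zeta$ implies $\chi|P\smile^\bullet\zeta|\xi$, $\chi|\xi\smile^\bullet\zeta|P$, $P|\chi\smile^\bullet\xi|\zeta$, $\xi|\chi\smile^\bullet P|\zeta$ if $P=src(\xi)$; $\chi\smile^\bullet\zeta$ implies $\chi|\varsigma\smile^\bullet\zeta|\xi$ and $\varsigma|\chi\smile^\bullet\xi|\zeta$ if $src(\varsigma)=src(\xi)$, $\ell(\varsigma)\in\mathcal B?$; $\chi\smile^\bullet\zeta$ and $\varsigma\smile^\bullet\xi$ imply $\chi|\varsigma\smile^\bullet\zeta|\xi$; $\chi\smile^\bullet\zeta$ implies $\chi\backslash c\smile^\bullet\zeta\backslash c$, $\chi[f]\smile^\bullet\zeta[f]$, $A{:}\chi\smile^\bullet A{:}\zeta$. $\equiv$ is the smallest equivalence on derivations $\chi$ with $\ell(\chi)\notin\mathcal B?$ such that (whenever derivations exist): $\chi|P\equiv\chi|Q$, $P|\chi\equiv Q|\chi$; $\chi|\varsigma\equiv\chi|P$, $\varsigma|\chi\equiv P|\chi$ if $\ell(\chi)\in\mathcal B!$; $\chi{+}P\equiv\chi\equiv P{+}\chi$, $A{:}\chi\equiv\chi$; $\chi\equiv\zeta$ implies $\chi\backslash c\equiv\zeta\backslash c$, $\chi[f]\equiv\zeta[f]$, $\chi|P\equiv\zeta|P$,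 $P|\chi\equiv P|\zeta$; $\chi\equiv\zeta$, $\varsigma\equiv\xi$ imply $\chi|\varsigma\equiv\zeta|\xi$. Abstract transitions are the $\equiv$-classes (elements: representatives), with $\ell([\chi]_\equiv)=\ell(\chi)$. $\nu\backslash c$ denotes the abstract transition containing $\chi\backslash c$ for $\chi\in\nu$. $P\models\mathit{en}(\nu)$ for an expression $P$ iff $P=src(\chi)$ for some representative $\chi$ of $\nu$; $\zeta\models\mathit{en}(\nu)$ for a derivation $\zeta$ iff $\chi\smile^\bullet\zeta$ for some representative $\chi$ of $\nu$. -}

module Defs where

open import Data.Product using (Σ; Σ-syntax; _×_; _,_)
open import Data.Sum using (_⊎_)
open import Data.Unit using (⊤)
open import Relation.Nullary using (¬_)
open import Relation.Binary.PropositionalEquality using (_≡_; _≢_)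

-- Syntax of ABC, over sets 𝒜 (agent identifiers), 𝔅 (broadcast
-- names), ℭ (handshake names).

-- Broadcast modes: send = "!", recv = "?"
data Mode : Set where
  send recv : Mode

-- H = ℭ ∪ { c̄ | c ∈ ℭ }
data H (ℭ : Set) : Set where
  nm : ℭ → H ℭ
  co : ℭ → H ℭ

bar : {ℭ : Set} → H ℭ → H ℭ
bar (nm c) = co c
bar (co c) = nm c

data Act (𝔅 ℭ : Set) : Set where
  br : 𝔅 → Mode → Act 𝔅 ℭ
  hs : H ℭ → Act 𝔅 ℭ
  τ  : Act 𝔅 ℭ

record Relab (𝔅 ℭ : Set) : Set where
  constructor relab
  field
    fB : 𝔅 → 𝔅
    fC : ℭ → ℭ
open Relab public

relH : {𝔅 ℭ : Set} → Relab 𝔅 ℭ → H ℭ → H ℭ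
relH f (nm c) = nm (fC f c)
relH f (co c) = co (fC f c)

relAct : {𝔅 ℭ : Set} → Relab 𝔅 ℭ → Act 𝔅 ℭ → Act 𝔅 ℭ
relAct f (br b m) = br (fB f b) m
relAct f (hs h)   = hs (relH f h)
relAct f τ        = τ

infixr 20 _∙_
infixl 15 _⊕_
infixl 16 _∥_
data Expr (𝒜 𝔅 ℭ : Set) : Set where
  𝟎    : Expr 𝒜 𝔅 ℭ
  _∙_  : Act 𝔅 ℭ → Expr 𝒜 𝔅 ℭ → Expr 𝒜 𝔅 ℭ
  _⊕_  : Expr 𝒜 𝔅 ℭ → Expr 𝒜 𝔅 ℭ → Expr 𝒜 𝔅 ℭ
  _∥_  : Expr 𝒜 𝔅 ℭ → Expr 𝒜 𝔅 ℭ → Expr 𝒜 𝔅 ℭ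
  _∖_  : Expr 𝒜 𝔅 ℭ → H ℭ → Expr 𝒜 𝔅 ℭ
  _⟦_⟧ : Expr 𝒜 𝔅 ℭ → Relab 𝔅 ℭ → Expr 𝒜 𝔅 ℭ
  ag   : 𝒜 → Expr 𝒜 𝔅 ℭ

data Guarded {𝒜 𝔅 ℭ : Set} : Expr 𝒜 𝔅 ℭ → Set where
  g𝟎 : Guarded 𝟎
  g∙ : ∀ {α E} → Guarded (α ∙ E)
  g⊕ : ∀ {E F} → Guarded E → Guarded F → Guarded (E ⊕ F)
  g∥ : ∀ {E F} → Guarded E → Guarded F → Guarded (E ∥ F)
  g∖ : ∀ {E c} → Guarded E → Guarded (E ∖ c)
  g⟦⟧ : ∀ {E f} → Guarded E → Guarded (E ⟦ f ⟧)

data Eta {𝔅 ℭ : Set} : Act 𝔅 ℭ → Set where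
  ηhs : ∀ {h} → Eta (hs h)
  ητ  : Eta τ

IsRecv : {𝔅 ℭ : Set} → Act 𝔅 ℭ → Set
IsRecv {𝔅} ℓ = Σ[ b ∈ 𝔅 ] ℓ ≡ br b recv

IsSend : {𝔅 ℭ : Set} → Act 𝔅 ℭ → Set
IsSend {𝔅} ℓ = Σ[ b ∈ 𝔅 ] ℓ ≡ br b send

NotRecv : {𝔅 ℭ : Set} → Act 𝔅 ℭ → Set
NotRecv ℓ = ¬ IsRecv ℓ

data Compose : Mode → Mode → Mode → Set where
  sr : Compose send recv send
  rs : Compose recv send send
  rr : Compose recv recv recv

data Sync {𝔅 ℭ : Set} : Act 𝔅 ℭ → Act 𝔅 ℭ → Act 𝔅 ℭ → Set where
  comm : ∀ {c} → Sync (hs c) (hs (bar c)) τ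
  bro  : ∀ {b m₁ m₂ m} → Compose m₁ m₂ m → Sync (br b m₁) (br b m₂) (br b m)

module Sem {𝒜 𝔅 ℭ : Set} (def : 𝒜 → Expr 𝒜 𝔅 ℭ) where

  E𝒳 = Expr 𝒜 𝔅 ℭ
  L𝒳 = Act 𝔅 ℭ
  H𝒳 = H ℭ

  -- CanRecv b E : E has a b?-transition (defined by the structure of
  -- the rules; needed to state the negative premise of (Bro-l/r)).
  data CanRecv (b : 𝔅) : E𝒳 → Set where
    cpre : ∀ {E} → CanRecv b (br b recv ∙ E)
    c⊕l  : ∀ {E F} → CanRecv b E → CanRecv b (E ⊕ F)
    c⊕r  : ∀ {E F} → CanRecv b F → CanRecv b (E ⊕ F)
    c∥l  : ∀ {E F} → CanRecv b E → CanRecv b (E ∥ F)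
    c∥r  : ∀ {E F} → CanRecv b F → CanRecv b (E ∥ F)
    c∖   : ∀ {E c} → CanRecv b E → CanRecv b (E ∖ c)
    c⟦⟧  : ∀ {E f b'} → CanRecv b' E → fB f b' ≡ b → CanRecv b (E ⟦ f ⟧)
    crec : ∀ {A} → CanRecv b (def A) → CanRecv b (ag A)

  SideOK : L𝒳 → E𝒳 → Set
  SideOK ℓ F = Eta ℓ ⊎ (Σ[ b ∈ 𝔅 ] Σ[ m ∈ Mode ] (ℓ ≡ br b m × ¬ CanRecv b F))

  -- Derivations of transitions (the proof terms are the derivations).
  -- left χ  = χ|Q  (Par-l / Bro-l),  right ζ = P|ζ  (Par-r / Bro-r),
  -- sync χ ς = χ|ς  (Comm / Bro-c),  sumL χ = χ+Q,  sumR χ = P+χ,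
  -- rel χ = χ[f],  res χ = χ\c,  rec χ = A:χ.
  -- Side conditions are irrelevant so that a derivation is determined by
  -- its rule and subderivations.
  infix 4 _—[_]→_
  data _—[_]→_ : E𝒳 → L𝒳 → E𝒳 → Set where
    act   : ∀ {α E} → (α ∙ E) —[ α ]→ E
    sumL  : ∀ {E F ℓ E'} → E —[ ℓ ]→ E' → (E ⊕ F) —[ ℓ ]→ E'
    sumR  : ∀ {E F ℓ F'} → F —[ ℓ ]→ F' → (E ⊕ F) —[ ℓ ]→ F'
    left  : ∀ {E F ℓ E'} → E —[ ℓ ]→ E' → .(SideOK ℓ F) → (E ∥ F) —[ ℓ ]→ (E' ∥ F)
    right : ∀ {E F ℓ F'} → F —[ ℓ ]→ F' → .(SideOK ℓ E) → (E ∥ F) —[ ℓ ]→ (E ∥ F')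
    sync  : ∀ {E F ℓ₁ ℓ₂ ℓ E' F'} → E —[ ℓ₁ ]→ E' → F —[ ℓ₂ ]→ F' →
            .(Sync ℓ₁ ℓ₂ ℓ) → (E ∥ F) —[ ℓ ]→ (E' ∥ F')
    rel   : ∀ {E ℓ E' f} → E —[ ℓ ]→ E' → (E ⟦ f ⟧) —[ relAct f ℓ ]→ (E' ⟦ f ⟧)
    res   : ∀ {E ℓ E' c} → E —[ ℓ ]→ E' → .(ℓ ≢ hs c) → .(ℓ ≢ hs (bar c)) →
            (E ∖ c) —[ ℓ ]→ (E' ∖ c)
    rec   : ∀ {A ℓ E'} → def A —[ ℓ ]→ E' → ag A —[ ℓ ]→ E'

  infix 4 _⌣_
  data _⌣_ : ∀ {E ℓ E' F ℓ' F'} → E —[ ℓ ]→ E' → F —[ ℓ' ]→ F' → Set where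
    lr  : ∀ {P ℓ P' Q ℓ' Q'} {χ : P —[ ℓ ]→ P'} {ζ : Q —[ ℓ' ]→ Q'} .{p q} →
          left {F = Q} χ p ⌣ right {E = P} ζ q
    rl  : ∀ {P ℓ P' Q ℓ' Q'} {χ : P —[ ℓ ]→ P'} {ζ : Q —[ ℓ' ]→ Q'} .{p q} →
          right {E = P} ζ q ⌣ left {F = Q} χ p
    sr  : ∀ {P ℓ P' Q ℓ₂ Q₂ ℓ' Q' ℓ''} {χ : P —[ ℓ ]→ P'} {ς : Q —[ ℓ₂ ]→ Q₂}
            {ζ : Q —[ ℓ' ]→ Q'} .{s : Sync ℓ ℓ₂ ℓ''} .{q} → IsRecv ℓ₂ →
          sync χ ς s ⌣ right {E = P} ζ q
    sl  : ∀ {P ℓ P' Q ℓ₂ Q₂ ℓ' Q' ℓ''} {χ : P —[ ℓ ]→ P'} {ς : Q —[ ℓ₂ ]→ Q₂}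
            {ζ : Q —[ ℓ' ]→ Q'} .{s : Sync ℓ₂ ℓ ℓ''} .{q} → IsRecv ℓ₂ →
          sync ς χ s ⌣ left {F = P} ζ q
    ⌣+l : ∀ {E ℓ E' F ℓ' F' P} {χ : E —[ ℓ ]→ E'} {ζ : F —[ ℓ' ]→ F'} → χ ⌣ ζ →
          sumL {F = P} χ ⌣ sumL {F = P} ζ
    ⌣+r : ∀ {E ℓ E' F ℓ' F' P} {χ : E —[ ℓ ]→ E'} {ζ : F —[ ℓ' ]→ F'} → χ ⌣ ζ →
          sumR {E = P} χ ⌣ sumR {E = P} ζ
    ⌣∥l : ∀ {E ℓ E' F ℓ' F' P} {χ : E —[ ℓ ]→ E'} {ζ : F —[ ℓ' ]→ F'} .{p q} → χ ⌣ ζ →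
          left {F = P} χ p ⌣ left {F = P} ζ q
    ⌣∥r : ∀ {E ℓ E' F ℓ' F' P} {χ : E —[ ℓ ]→ E'} {ζ : F —[ ℓ' ]→ F'} .{p q} → χ ⌣ ζ →
          right {E = P} χ p ⌣ right {E = P} ζ q
    -- χ|P ⌣ ζ|ξ,  χ|ξ ⌣ ζ|P,  P|χ ⌣ ξ|ζ,  ξ|χ ⌣ P|ζ   (P = src ξ)
    lS  : ∀ {E ℓ E' F ℓ' F' P ℓx P' ℓs} {χ : E —[ ℓ ]→ E'} {ζ : F —[ ℓ' ]→ F'}
            {ξ : P —[ ℓx ]→ P'} .{p} .{s : Sync ℓ' ℓx ℓs} → χ ⌣ ζ →
          left {F = P} χ p ⌣ sync ζ ξ s
    Sl  : ∀ {E ℓ E' F ℓ' F' P ℓx P' ℓs} {χ : E —[ ℓ ]→ E'} {ζ : F —[ ℓ' ]→ F'}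
            {ξ : P —[ ℓx ]→ P'} .{p} .{s : Sync ℓ ℓx ℓs} → χ ⌣ ζ →
          sync χ ξ s ⌣ left {F = P} ζ p
    rS  : ∀ {E ℓ E' F ℓ' F' P ℓx P' ℓs} {χ : E —[ ℓ ]→ E'} {ζ : F —[ ℓ' ]→ F'}
            {ξ : P —[ ℓx ]→ P'} .{p} .{s : Sync ℓx ℓ' ℓs} → χ ⌣ ζ →
          right {E = P} χ p ⌣ sync ξ ζ s
    Sr  : ∀ {E ℓ E' F ℓ' F' P ℓx P' ℓs} {χ : E —[ ℓ ]→ E'} {ζ : F —[ ℓ' ]→ F'}
            {ξ : P —[ ℓx ]→ P'} .{p} .{s : Sync ℓx ℓ ℓs} → χ ⌣ ζ →
          sync ξ χ s ⌣ right {E = P} ζ p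
    SSl : ∀ {E ℓ E' F ℓ' F' Q ℓ₂ Q₂ ℓx Qx ℓs ℓt} {χ : E —[ ℓ ]→ E'} {ζ : F —[ ℓ' ]→ F'}
            {ς : Q —[ ℓ₂ ]→ Q₂} {ξ : Q —[ ℓx ]→ Qx}
            .{s : Sync ℓ ℓ₂ ℓs} .{t : Sync ℓ' ℓx ℓt} → χ ⌣ ζ → IsRecv ℓ₂ →
          sync χ ς s ⌣ sync ζ ξ t
    SSr : ∀ {E ℓ E' F ℓ' F' Q ℓ₂ Q₂ ℓx Qx ℓs ℓt} {χ : E —[ ℓ ]→ E'} {ζ : F —[ ℓ' ]→ F'}
            {ς : Q —[ ℓ₂ ]→ Q₂} {ξ : Q —[ ℓx ]→ Qx}
            .{s : Sync ℓ₂ ℓ ℓs} .{t : Sync ℓx ℓ' ℓt} → χ ⌣ ζ → IsRecv ℓ₂ →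
          sync ς χ s ⌣ sync ξ ζ t
    SS  : ∀ {E ℓ E' F ℓ' F' G ℓ₂ G' K ℓx K' ℓs ℓt}
            {χ : E —[ ℓ ]→ E'} {ζ : F —[ ℓ' ]→ F'}
            {ς : G —[ ℓ₂ ]→ G'} {ξ : K —[ ℓx ]→ K'}
            .{s : Sync ℓ ℓ₂ ℓs} .{t : Sync ℓ' ℓx ℓt} → χ ⌣ ζ → ς ⌣ ξ →
          sync χ ς s ⌣ sync ζ ξ t
    ⌣res : ∀ {E ℓ E' F ℓ' F' c} {χ : E —[ ℓ ]→ E'} {ζ : F —[ ℓ' ]→ F'} .{p q p' q'} → χ ⌣ ζ →
          res {c = c} χ p q ⌣ res {c = c} ζ p' q'
    ⌣rel : ∀ {E ℓ E' F ℓ' F' f} {χ : E —[ ℓ ]→ E'} {ζ : F —[ ℓ' ]→ F'} → χ ⌣ ζ →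
          rel {f = f} χ ⌣ rel {f = f} ζ
    ⌣rec : ∀ {A ℓ E' ℓ' F'} {χ : def A —[ ℓ ]→ E'} {ζ : def A —[ ℓ' ]→ F'} → χ ⌣ ζ →
          rec {A = A} χ ⌣ rec {A = A} ζ

  -- The equivalence ≡ on derivations with labels ∉ 𝔅? (written ≈)
  infix 4 _≈_
  data _≈_ : ∀ {E ℓ E' F ℓ' F'} → E —[ ℓ ]→ E' → F —[ ℓ' ]→ F' → Set where
    ≈refl  : ∀ {E ℓ E'} {χ : E —[ ℓ ]→ E'} → NotRecv ℓ → χ ≈ χ
    ≈sym   : ∀ {E ℓ E' F ℓ' F'} {χ : E —[ ℓ ]→ E'} {ζ : F —[ ℓ' ]→ F'} → χ ≈ ζ → ζ ≈ χ
    ≈trans : ∀ {E ℓ E' F ℓ' F' G ℓ'' G'} {χ : E —[ ℓ ]→ E'} {ζ : F —[ ℓ' ]→ F'}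
               {ξ : G —[ ℓ'' ]→ G'} → χ ≈ ζ → ζ ≈ ξ → χ ≈ ξ
    lPQ : ∀ {E ℓ E' P Q} {χ : E —[ ℓ ]→ E'} .{p q} → NotRecv ℓ →
          left {F = P} χ p ≈ left {F = Q} χ q
    rPQ : ∀ {E ℓ E' P Q} {χ : E —[ ℓ ]→ E'} .{p q} → NotRecv ℓ →
          right {E = P} χ p ≈ right {E = Q} χ q
    Sl  : ∀ {E ℓ E' G ℓ₂ G' ℓs P} {χ : E —[ ℓ ]→ E'} {ς : G —[ ℓ₂ ]→ G'}
            .{s : Sync ℓ ℓ₂ ℓs} .{p} → IsSend ℓ →
          sync χ ς s ≈ left {F = P} χ p
    Sr  : ∀ {E ℓ E' G ℓ₂ G' ℓs P} {χ : E —[ ℓ ]→ E'} {ς : G —[ ℓ₂ ]→ G'}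
            .{s : Sync ℓ₂ ℓ ℓs} .{p} → IsSend ℓ →
          sync ς χ s ≈ right {E = P} χ p
    +l  : ∀ {E ℓ E' P} {χ : E —[ ℓ ]→ E'} → NotRecv ℓ → sumL {F = P} χ ≈ χ
    +r  : ∀ {E ℓ E' P} {χ : E —[ ℓ ]→ E'} → NotRecv ℓ → χ ≈ sumR {E = P} χ
    :r  : ∀ {A ℓ E'} {χ : def A —[ ℓ ]→ E'} → NotRecv ℓ → rec {A = A} χ ≈ χ
    ≈res : ∀ {E ℓ E' F ℓ' F' c} {χ : E —[ ℓ ]→ E'} {ζ : F —[ ℓ' ]→ F'} .{p q p' q'} →
           χ ≈ ζ → res {c = c} χ p q ≈ res {c = c} ζ p' q'
    ≈rel : ∀ {E ℓ E' F ℓ' F' f} {χ : E —[ ℓ ]→ E'} {ζ : F —[ ℓ' ]→ F'} →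
           χ ≈ ζ → rel {f = f} χ ≈ rel {f = f} ζ
    ≈∥l  : ∀ {E ℓ E' F ℓ' F' P} {χ : E —[ ℓ ]→ E'} {ζ : F —[ ℓ' ]→ F'} .{p q} →
           χ ≈ ζ → left {F = P} χ p ≈ left {F = P} ζ q
    ≈∥r  : ∀ {E ℓ E' F ℓ' F' P} {χ : E —[ ℓ ]→ E'} {ζ : F —[ ℓ' ]→ F'} .{p q} →
           χ ≈ ζ → right {E = P} χ p ≈ right {E = P} ζ q
    ≈S   : ∀ {E ℓ E' F ℓ' F' G ℓ₂ G' K ℓx K' ℓs ℓt}
             {χ : E —[ ℓ ]→ E'} {ζ : F —[ ℓ' ]→ F'}
             {ς : G —[ ℓ₂ ]→ G'} {ξ : K —[ ℓx ]→ K'}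
             .{s : Sync ℓ ℓ₂ ℓs} .{t : Sync ℓ' ℓx ℓt} → χ ≈ ζ → ς ≈ ξ →
           sync χ ς s ≈ sync ζ ξ t

  -- Abstract transitions: ≡-classes, given by a representative χ with
  -- ℓ(χ) ∉ 𝔅?.  The elements of the class are the χ' with χ' ≈ rep.
  record AbsTr : Set where
    constructor ⟦_,_⟧
    field
      {asrc alab atgt} : _
      rep  : asrc —[ alab ]→ atgt
      .nr  : NotRecv alab
  open AbsTr public

  restrictA : (ν : AbsTr) (c : H𝒳) → alab ν ≢ hs c → alab ν ≢ hs (bar c) → AbsTr
  restrictA ⟦ χ , nr ⟧ c p q = ⟦ res {c = c} χ p q , nr ⟧

  -- states of 𝒰: expressions and derivations
  data State : Set where
    exprS : E𝒳 → State
    derS  : ∀ {E ℓ E'} → E —[ ℓ ]→ E' → State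

  -- u\c is a state of 𝒰 (for derivations it requires ℓ(u) ∉ {c, c̄})
  ResOK : State → H𝒳 → Set
  ResOK (exprS _) c = ⊤
  ResOK (derS {ℓ = ℓ} _) c = ℓ ≢ hs c × ℓ ≢ hs (bar c)

  restrictS : (u : State) (c : H𝒳) → ResOK u c → State
  restrictS (exprS P) c _ = exprS (P ∖ c)
  restrictS (derS ζ) c (p , q) = derS (res {c = c} ζ p q)

  _⊨en_ : State → AbsTr → Set
  exprS P ⊨en ν =
    Σ[ ℓ ∈ L𝒳 ] Σ[ T ∈ E𝒳 ] Σ[ χ ∈ P —[ ℓ ]→ T ] (χ ≈ rep ν)
  derS ζ ⊨en ν =
    Σ[ S ∈ E𝒳 ] Σ[ ℓ ∈ L𝒳 ] Σ[ T ∈ E𝒳 ] Σ[ χ ∈ S —[ ℓ ]→ T ] (χ ≈ rep ν × χ ⌣ ζ)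

-- A derivation ≈-equivalent to a representative of ν carries the label of ν,
-- so it avoids c and c̄ and may be restricted; restriction is a congruence for
-- both ≈ and ⌣, which turns the enabling witness for u into one for u \ c.
module Submission where

open import Data.Irrelevant using (Irrelevant; [_]; map; zipWith)
open import Data.Product using (_,_)
open import Relation.Binary.PropositionalEquality using (_≡_; _≢_; refl; sym; trans; cong)

open import Defs

module _ {𝔅 ℭ : Set} where
  private variable ℓ₁ ℓ₂ ℓ ℓ₁' ℓ₂' ℓ' : Act 𝔅 ℭ

  Sync-functional : Sync ℓ₁ ℓ₂ ℓ → Sync ℓ₁ ℓ₂ ℓ' → ℓ ≡ ℓ'
  Sync-functional comm     comm     = refl
  Sync-functional (bro sr) (bro sr) = refl
  Sync-functional (bro rs) (bro rs) = refl
  Sync-functional (bro rr) (bro rr) = refl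

  Sync-cong : ℓ₁ ≡ ℓ₁' → ℓ₂ ≡ ℓ₂' → Sync ℓ₁ ℓ₂ ℓ → Sync ℓ₁' ℓ₂' ℓ' → ℓ ≡ ℓ'
  Sync-cong refl refl = Sync-functional

  Sync-sendˡ : IsSend ℓ₁ → Sync ℓ₁ ℓ₂ ℓ → ℓ ≡ ℓ₁
  Sync-sendˡ (_ , refl) (bro sr) = refl

  Sync-sendʳ : IsSend ℓ₂ → Sync ℓ₁ ℓ₂ ℓ → ℓ ≡ ℓ₂
  Sync-sendʳ (_ , refl) (bro rs) = refl

module _ {𝒜 𝔅 ℭ : Set} (def : 𝒜 → Expr 𝒜 𝔅 ℭ) where
  open Sem def

  -- The side conditions of a derivation are irrelevant, so label equality
  -- can only be extracted irrelevantly.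
  ≈⇒label≡ : ∀ {E ℓ E' F ℓ' F'} {χ : E —[ ℓ ]→ E'} {ζ : F —[ ℓ' ]→ F'} →
             χ ≈ ζ → Irrelevant (ℓ ≡ ℓ')
  ≈⇒label≡ (≈refl _)      = [ refl ]
  ≈⇒label≡ (≈sym e)       = map sym (≈⇒label≡ e)
  ≈⇒label≡ (≈trans e f)   = zipWith trans (≈⇒label≡ e) (≈⇒label≡ f)
  ≈⇒label≡ (lPQ _)        = [ refl ]
  ≈⇒label≡ (rPQ _)        = [ refl ]
  ≈⇒label≡ (Sl {s = s} x) = [ Sync-sendˡ x s ]
  ≈⇒label≡ (Sr {s = s} x) = [ Sync-sendʳ x s ]
  ≈⇒label≡ (+l _)         = [ refl ]
  ≈⇒label≡ (+r _)         = [ refl ]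
  ≈⇒label≡ (:r _)         = [ refl ]
  ≈⇒label≡ (≈res e)       = ≈⇒label≡ e
  ≈⇒label≡ (≈rel e)       = map (cong (relAct _)) (≈⇒label≡ e)
  ≈⇒label≡ (≈∥l e)        = ≈⇒label≡ e
  ≈⇒label≡ (≈∥r e)        = ≈⇒label≡ e
  ≈⇒label≡ (≈S {s = s} {t = t} e f) with ≈⇒label≡ e | ≈⇒label≡ f
  ... | [ x ] | [ y ] = [ Sync-cong x y s t ]

  ≈-resp-≢ : ∀ {E ℓ E' F ℓ' F'} {χ : E —[ ℓ ]→ E'} {ζ : F —[ ℓ' ]→ F'} {a : L𝒳} →
             χ ≈ ζ → ℓ' ≢ a → Irrelevant (ℓ ≢ a)
  ≈-resp-≢ e ℓ'≢a = map (λ ℓ≡ℓ' ℓ≡a → ℓ'≢a (trans (sym ℓ≡ℓ') ℓ≡a)) (≈⇒label≡ e)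

  restrict : ∀ {E ℓ E'} {c : H𝒳} → E —[ ℓ ]→ E' →
             Irrelevant (ℓ ≢ hs c) → Irrelevant (ℓ ≢ hs (bar c)) → (E ∖ c) —[ ℓ ]→ (E' ∖ c)
  restrict χ [ p ] [ q ] = res χ p q

  restrict-⊨en : (u : State) (ν : AbsTr) (c : H𝒳)
                 (p : alab ν ≢ hs c) (q : alab ν ≢ hs (bar c)) (ok : ResOK u c) →
                 u ⊨en ν → restrictS u c ok ⊨en restrictA ν c p q
  restrict-⊨en (exprS _) ⟦ _ , _ ⟧ _ p q _ (ℓ , _ , χ , χ≈ν) =
    ℓ , _ , restrict χ (≈-resp-≢ χ≈ν p) (≈-resp-≢ χ≈ν q) , ≈res χ≈ν
  restrict-⊨en (derS _) ⟦ _ , _ ⟧ _ p q _ (_ , ℓ , _ , χ , χ≈ν , χ⌣ζ) =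
    _ , ℓ , _ , restrict χ (≈-resp-≢ χ≈ν p) (≈-resp-≢ χ≈ν q) , ≈res χ≈ν , ⌣res χ⌣ζ

lemma4 : {𝒜 𝔅 ℭ : Set} (def : 𝒜 → Expr 𝒜 𝔅 ℭ) → (∀ A → Guarded (def A)) →
    let open Sem def in
    (u : State) (ν : AbsTr) (c : H ℭ) →
    (p : alab ν ≢ hs c) (q : alab ν ≢ hs (bar c)) (ok : ResOK u c) →
    u ⊨en ν → restrictS u c ok ⊨en restrictA ν c p q
lemma4 def _ = restrict-⊨en def
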